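{- Let $a_1,b_1$ be relatively prime positive integers. Then there is at most one pair $(m,n)$ of positive integers together with a smooth arithmetical structure on $\mathcal{P}_{m,n}$ whose labels at the vertices $a_1$ and $b_1$ are $a_1$ and $b_1$ respectively. Moreover, for such a structure one has $m=F(2b_1,a_1)-1$ and $n=F(2a_1,b_1)-1$.
   Context: For positive integers $m,n$, the multigraph $\mathcal{P}_{m,n}$ has vertices $a_1,\ldots,a_m,b_1,\ldots,b_n$, a single edge between $a_i$ and $a_{i+1}$ for $1\le i<m$, a single edge between $b_i$ and $b_{i+1}$ for $1\le i<n$, and two parallel edges between $a_1$ and $b_1$. An arithmetical structure is an assignment of a positive integer label to each vertex such that the labels have gcd $1$ and each vertex's label divides the sum of its neighbors' labels counted with edge multiplicity; we write $a_i,b_i$ also for the labels. It is smooth if $a_1>\cdots>a_m$ and $b_1>\cdots>b_n$. For integers $x_1>0$, $x_2\ge0$, define a sequence by letting $x_i$ (for $i\ge3$) be the least nonnegative residue of $-x_{i-2}$ modulo $x_{i-1}$ (as long as $x_{i-1}>0$), and let $F(x_1,x_2)$ be the largest index $i$ with $x_i>0$. For example $F(8,5)=4$ (sequence $8,5,2,1,0$). -}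

module Defs where

open import Data.Nat using (ℕ; zero; suc; _+_; _*_; _∸_; _≤_; _<_; _≤ᵇ_)
open import Data.Nat.DivMod using (_%_)
open import Data.Nat.Divisibility using (_∣_)
open import Data.Product using (_×_; _,_; proj₁)
open import Data.Bool using (if_then_else_)
open import Relation.Binary.PropositionalEquality using (_≡_)

-- Labels of P_{m,n} are given as functions a b : ℕ → ℕ, where only the
-- values a 1 … a m and b 1 … b n are meaningful (1-based indexing as in the paper).

ext : ℕ → (ℕ → ℕ) → ℕ → ℕ
ext m a i = if i ≤ᵇ m then a i else 0

record Arith (m n : ℕ) (a b : ℕ → ℕ) : Set where
  field
    a-pos : ∀ i → 1 ≤ i → i ≤ m → 0 < a i
    b-pos : ∀ i → 1 ≤ i → i ≤ n → 0 < b i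
    gcd1  : ∀ d → (∀ i → 1 ≤ i → i ≤ m → d ∣ a i)
                → (∀ i → 1 ≤ i → i ≤ n → d ∣ b i) → d ∣ 1
    -- vertex a_1: neighbours a_2 (if m ≥ 2) and b_1 with a double edge
    div-a1 : a 1 ∣ ext m a 2 + 2 * b 1
    div-b1 : b 1 ∣ ext n b 2 + 2 * a 1
    div-a : ∀ i → 2 ≤ i → i ≤ m → a i ∣ a (i ∸ 1) + ext m a (suc i)
    div-b : ∀ i → 2 ≤ i → i ≤ n → b i ∣ b (i ∸ 1) + ext n b (suc i)

record Smooth (m n : ℕ) (a b : ℕ → ℕ) : Set where
  field
    a-dec : ∀ i → 1 ≤ i → i < m → a (suc i) < a i
    b-dec : ∀ i → 1 ≤ i → i < n → b (suc i) < b i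

SmoothArith : (m n : ℕ) (a b : ℕ → ℕ) → Set
SmoothArith m n a b = Arith m n a b × Smooth m n a b

-- least nonnegative residue of -y modulo z (only used for z > 0; 0 otherwise)
negmod : ℕ → ℕ → ℕ
negmod y zero    = 0
negmod y (suc z) = (suc z ∸ y % suc z) % suc z

-- pairs x₁ x₂ k = (x_{k+1}, x_{k+2}); once a zero occurs the sequence stays 0
pairs : ℕ → ℕ → ℕ → ℕ × ℕ
pairs x₁ x₂ zero = (x₁ , x₂)
pairs x₁ x₂ (suc k) with pairs x₁ x₂ k
... | (u , v) = (v , negmod u v)

-- xseq x₁ x₂ i = x_i for i ≥ 1 (1-based); xseq x₁ x₂ 0 = 0 (dummy)
xseq : ℕ → ℕ → ℕ → ℕ
xseq x₁ x₂ zero    = 0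
xseq x₁ x₂ (suc k) = proj₁ (pairs x₁ x₂ k)

-- IsF x₁ x₂ k : k is the largest index i with x_i > 0, i.e. k = F(x₁,x₂)
IsF : ℕ → ℕ → ℕ → Set
IsF x₁ x₂ k = (0 < xseq x₁ x₂ k) × (∀ j → k < j → xseq x₁ x₂ j ≡ 0)

module Submission where

-- A smooth arithmetical structure on P_{m,n} is recovered from (a₁, b₁) by
-- the sequence x of the definition of F.  View the leg a₁ > a₂ > … > a_m as a
-- chain hanging off an external weight c = 2b₁: the divisibility condition
-- at a_i says a_i ∣ x + a_{i+1}, where x is the previous term (c for i = 1)
-- and a_{m+1} = 0, while smoothness gives 0 ≤ a_{i+1} < a_i.  Hence
-- a_{i+1} is exactly the least nonnegative residue of -x modulo a_i, so the
-- sequence starting from (2b₁, a₁) is 2b₁, a₁, a₂, …, a_m, 0, 0, …  and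
-- F(2b₁, a₁) = m + 1; symmetrically for the b-leg with c = 2a₁.
--
-- Uniqueness follows since m, n and
-- all labels are read off the sequences, which depend only on a₁ and b₁.

open import Defs
open import Data.Nat using (ℕ; zero; suc; _+_; _*_; _∸_; _≤_; _<_; _≤ᵇ_; z≤n; s≤s; _≤?_)
open import Data.Nat.Properties
open import Data.Nat.DivMod using (_%_; m%n<n; m<n⇒m%n≡m; n%n≡0; %-distribˡ-+)
open import Data.Nat.Divisibility using (_∣_; divides; m%n≡0⇒n∣m; n∣m⇒m%n≡0)
open import Data.Nat.Coprimality using (Coprime)
open import Data.Product using (_×_; _,_; proj₁; proj₂)
open import Data.Sum using (_⊎_; inj₁; inj₂)
open import Data.Bool using (true; false; T)
open import Data.Unit using (tt)
open import Relation.Nullary using (yes; no; contradiction)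
open import Relation.Binary using (tri<; tri≈; tri>)
open import Relation.Binary.PropositionalEquality
  using (_≡_; refl; sym; trans; cong; cong₂; subst; module ≡-Reasoning)
open ≡-Reasoning

ext-in : ∀ {m i} (a : ℕ → ℕ) → i ≤ m → ext m a i ≡ a i
ext-in {m} {i} a i≤m with i ≤ᵇ m | ≤⇒≤ᵇ i≤m
... | true | _ = refl

ext-out : ∀ {m i} (a : ℕ → ℕ) → m < i → ext m a i ≡ 0
ext-out {m} {i} a m<i with i ≤ᵇ m in eq
... | true  = contradiction (≤ᵇ⇒≤ i m (subst T (sym eq) tt)) (<⇒≱ m<i)
... | false = refl

multiple-below-double : ∀ {v x} → v ∣ x → x < v + v → x ≡ 0 ⊎ x ≡ v
multiple-below-double (divides zero eq)          _ = inj₁ eq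
multiple-below-double {v} (divides (suc zero) eq) _ = inj₂ (trans eq (+-identityʳ v))
multiple-below-double {v} (divides (suc (suc q)) refl) x<2v =
  contradiction (+-monoʳ-≤ v (m≤m+n v (q * v))) (<⇒≱ x<2v)

-- negmod u v is characterised as the unique w < v with v ∣ u + w.
-- With r = u mod v we have v ∣ r + w and r + w < 2v, so r + w is 0 or v;
-- in both cases (v - r) mod v = w.
negmod-unique : ∀ u v w → 0 < v → w < v → v ∣ u + w → negmod u v ≡ w
negmod-unique u v@(suc _) w _ w<v v∣u+w
  with multiple-below-double v∣r+w (+-mono-< (m%n<n u v) w<v)
  where
  r = u % v
  v∣r+w : v ∣ r + w
  v∣r+w = m%n≡0⇒n∣m (r + w) v (begin
    (r + w) % v           ≡⟨ cong (λ t → (r + t) % v) (sym (m<n⇒m%n≡m w<v)) ⟩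
    (r + w % v) % v       ≡⟨ sym (%-distribˡ-+ u w v) ⟩
    (u + w) % v           ≡⟨ n∣m⇒m%n≡0 (u + w) v v∣u+w ⟩
    0                     ∎)
... | inj₁ r+w≡0 = begin
  (v ∸ u % v) % v  ≡⟨ cong (λ t → (v ∸ t) % v) (m+n≡0⇒m≡0 (u % v) r+w≡0) ⟩
  v % v            ≡⟨ n%n≡0 v ⟩
  0                ≡⟨ sym (m+n≡0⇒n≡0 (u % v) r+w≡0) ⟩
  w                ∎
... | inj₂ r+w≡v = begin
  (v ∸ u % v) % v          ≡⟨ cong (λ t → (t ∸ u % v) % v) (sym r+w≡v) ⟩
  (u % v + w ∸ u % v) % v  ≡⟨ cong (_% v) (m+n∸m≡n (u % v) w) ⟩
  w % v                    ≡⟨ m<n⇒m%n≡m w<v ⟩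
  w                        ∎

pairs-vanish : ∀ {x y k} u → pairs x y k ≡ (u , 0) → ∀ {j} → k < j → pairs x y j ≡ (0 , 0)
pairs-vanish u eq {suc j} (s≤s k≤j) with m≤n⇒m<n∨m≡n k≤j
... | inj₁ k<j  rewrite pairs-vanish u eq k<j = refl
... | inj₂ refl rewrite eq = refl

IsF-unique : ∀ {x y k k′} → IsF x y k → IsF x y k′ → k ≡ k′
IsF-unique {k = k} {k′} (pos , after) (pos′ , after′) with <-cmp k k′
... | tri< k<k′ _ _ = contradiction (after k′ k<k′) (>⇒≢ pos′)
... | tri≈ _ k≡k′ _ = k≡k′
... | tri> _ _ k′<k = contradiction (after′ k k′<k) (>⇒≢ pos)

record DescendingChain (c m : ℕ) (a : ℕ → ℕ) : Set where
  field
    nonempty  : 1 ≤ m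
    positive  : ∀ i → 1 ≤ i → i ≤ m → 0 < a i
    div-first : a 1 ∣ ext m a 2 + c
    div-inner : ∀ i → 2 ≤ i → i ≤ m → a i ∣ a (i ∸ 1) + ext m a (suc i)
    decrease  : ∀ i → 1 ≤ i → i < m → a (suc i) < a i

module _ {c m : ℕ} {a : ℕ → ℕ} (chain : DescendingChain c m a) where
  open DescendingChain chain

  term : ℕ → ℕ
  term zero    = c
  term (suc k) = a (suc k)

  next-below : ∀ k → suc k ≤ m → ext m a (suc (suc k)) < a (suc k)
  next-below k k<m with suc (suc k) ≤? m
  ... | yes k+1<m = subst (_< a (suc k)) (sym (ext-in a k+1<m)) (decrease (suc k) (s≤s z≤n) k+1<m)
  ... | no  k+1≮m = subst (_< a (suc k)) (sym (ext-out a (≰⇒> k+1≮m))) (positive (suc k) (s≤s z≤n) k<m)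

  divides-neighbours : ∀ k → suc k ≤ m → a (suc k) ∣ term k + ext m a (suc (suc k))
  divides-neighbours zero    _   = subst (a 1 ∣_) (+-comm (ext m a 2) c) div-first
  divides-neighbours (suc k) k<m = div-inner (suc (suc k)) (s≤s (s≤s z≤n)) k<m

  chain-pairs : ∀ k → k ≤ m → pairs c (a 1) k ≡ (term k , ext m a (suc k))
  chain-pairs zero    _   = cong (c ,_) (sym (ext-in a nonempty))
  chain-pairs (suc k) k<m rewrite chain-pairs k (<⇒≤ k<m) | ext-in a k<m =
    cong (a (suc k) ,_)
      (negmod-unique (term k) (a (suc k)) (ext m a (suc (suc k)))
        (positive (suc k) (s≤s z≤n) k<m) (next-below k k<m) (divides-neighbours k k<m))

  term-label : ∀ k → 1 ≤ k → term k ≡ a k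
  term-label (suc k) _ = refl

  chain-end : pairs c (a 1) m ≡ (a m , 0)
  chain-end = trans (chain-pairs m ≤-refl) (cong₂ _,_ (term-label m nonempty) (ext-out a ≤-refl))

  chain-isF : IsF c (a 1) (suc m)
  chain-isF = subst (0 <_) (sym (cong proj₁ chain-end)) (positive m nonempty ≤-refl)
            , λ { (suc j) (s≤s m<j) → cong proj₁ (pairs-vanish (a m) chain-end m<j) }

  chain-labels : ∀ i → 1 ≤ i → i ≤ m → a i ≡ xseq c (a 1) (suc i)
  chain-labels (suc i) _ i<m = sym (cong proj₁ (chain-pairs (suc i) i<m))

a-leg : ∀ {m n a b} → 1 ≤ m → SmoothArith m n a b → DescendingChain (2 * b 1) m a
a-leg m≥1 (A , S) = record
  { nonempty = m≥1 ; positive = Arith.a-pos A ; div-first = Arith.div-a1 A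
  ; div-inner = Arith.div-a A ; decrease = Smooth.a-dec S }

b-leg : ∀ {m n a b} → 1 ≤ n → SmoothArith m n a b → DescendingChain (2 * a 1) n b
b-leg n≥1 (A , S) = record
  { nonempty = n≥1 ; positive = Arith.b-pos A ; div-first = Arith.div-b1 A
  ; div-inner = Arith.div-b A ; decrease = Smooth.b-dec S }

smooth-F : ∀ {m n a b a₁ b₁} → 1 ≤ m → 1 ≤ n → SmoothArith m n a b → a 1 ≡ a₁ → b 1 ≡ b₁ →
  IsF (2 * b₁) a₁ (suc m) × IsF (2 * a₁) b₁ (suc n)
smooth-F m≥1 n≥1 S refl refl = chain-isF (a-leg m≥1 S) , chain-isF (b-leg n≥1 S)

smooth-labels : ∀ {m n a b a₁ b₁} → 1 ≤ m → 1 ≤ n → SmoothArith m n a b → a 1 ≡ a₁ → b 1 ≡ b₁ →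
  (∀ i → 1 ≤ i → i ≤ m → a i ≡ xseq (2 * b₁) a₁ (suc i))
    × (∀ i → 1 ≤ i → i ≤ n → b i ≡ xseq (2 * a₁) b₁ (suc i))
smooth-labels m≥1 n≥1 S refl refl = chain-labels (a-leg m≥1 S) , chain-labels (b-leg n≥1 S)

smooth-unique : ∀ {m n m′ n′ a b a′ b′ a₁ b₁} → 1 ≤ m → 1 ≤ n → 1 ≤ m′ → 1 ≤ n′ →
  SmoothArith m n a b → a 1 ≡ a₁ → b 1 ≡ b₁ →
  SmoothArith m′ n′ a′ b′ → a′ 1 ≡ a₁ → b′ 1 ≡ b₁ →
  (m ≡ m′) × (n ≡ n′)
    × (∀ i → 1 ≤ i → i ≤ m → a i ≡ a′ i)
    × (∀ i → 1 ≤ i → i ≤ n → b i ≡ b′ i)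
smooth-unique {m} {n} {m′} {n′} {a} {b} {a′} {b′} m≥1 n≥1 m′≥1 n′≥1 S ea eb S′ ea′ eb′ =
  m≡m′ , n≡n′ , same-a , same-b
  where
  m≡m′ : m ≡ m′
  m≡m′ = suc-injective (IsF-unique (proj₁ (smooth-F m≥1 n≥1 S ea eb)) (proj₁ (smooth-F m′≥1 n′≥1 S′ ea′ eb′)))

  n≡n′ : n ≡ n′
  n≡n′ = suc-injective (IsF-unique (proj₂ (smooth-F m≥1 n≥1 S ea eb)) (proj₂ (smooth-F m′≥1 n′≥1 S′ ea′ eb′)))

  same-a : ∀ i → 1 ≤ i → i ≤ m → a i ≡ a′ i
  same-a i i≥1 i≤m = trans (proj₁ (smooth-labels m≥1 n≥1 S ea eb) i i≥1 i≤m)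
    (sym (proj₁ (smooth-labels m′≥1 n′≥1 S′ ea′ eb′) i i≥1 (subst (i ≤_) m≡m′ i≤m)))

  same-b : ∀ i → 1 ≤ i → i ≤ n → b i ≡ b′ i
  same-b i i≥1 i≤n = trans (proj₂ (smooth-labels m≥1 n≥1 S ea eb) i i≥1 i≤n)
    (sym (proj₂ (smooth-labels m′≥1 n′≥1 S′ ea′ eb′) i i≥1 (subst (i ≤_) n≡n′ i≤n)))

lemma2p6 : (a₁ b₁ : ℕ) → 0 < a₁ → 0 < b₁ → Coprime a₁ b₁ →
    ((m n m′ n′ : ℕ) (a b a′ b′ : ℕ → ℕ) →
      1 ≤ m → 1 ≤ n → 1 ≤ m′ → 1 ≤ n′ →
      SmoothArith m n a b → a 1 ≡ a₁ → b 1 ≡ b₁ →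
      SmoothArith m′ n′ a′ b′ → a′ 1 ≡ a₁ → b′ 1 ≡ b₁ →
      (m ≡ m′) × (n ≡ n′)
        × (∀ i → 1 ≤ i → i ≤ m → a i ≡ a′ i)
        × (∀ i → 1 ≤ i → i ≤ n → b i ≡ b′ i))
    × ((m n : ℕ) (a b : ℕ → ℕ) → 1 ≤ m → 1 ≤ n →
      SmoothArith m n a b → a 1 ≡ a₁ → b 1 ≡ b₁ →
      IsF (2 * b₁) a₁ (suc m) × IsF (2 * a₁) b₁ (suc n))
lemma2p6 a₁ b₁ _ _ _ =
  (λ _ _ _ _ _ _ _ _ → smooth-unique) , (λ _ _ _ _ → smooth-F)
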